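{- Let $Q = v_1, e_1, \ldots, e_{s-1}, v_s$ be a path in a graph and let $q \geq 2$ be an integer. Let $A'$ and $B'$ be nonempty subsets of $E(Q) = \{e_1,\dots,e_{s-1}\}$ such that for each $e_i \in A'$ and $e_j \in B'$, either $i = j$ or $|i-j| \geq q$. Then: (i) if $A' = B'$, then $s - 1 \geq 1 + q(|A'| - 1)$, with equality only if $A' = \{e_1, e_{1+q}, e_{1+2q}, \ldots, e_{s-1}\}$; (ii) if $B' \neq A'$, then $s - 1 \geq |A'| + |B'| + q - 2$, with equality only if $A' \subset B'$ or $B' \subset A'$. -}

module Defs where

open import Data.Nat using (ℕ; _≤_; ∣_-_∣)
open import Data.Fin using (Fin; toℕ)
open import Data.Fin.Subset using (Subset; _∈_)
open import Relation.Binary.PropositionalEquality using (_≡_)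
open import Data.Sum using (_⊎_)

-- The edges e_1, ..., e_{s-1} of the path Q are represented by Fin (s ∸ 1):
-- the element i : Fin (s ∸ 1) stands for the edge e_{toℕ i + 1}.
-- Subsets of E(Q) are then Subset (s ∸ 1).

Separated : ∀ {m} → ℕ → Subset m → Subset m → Set
Separated {m} q A B =
  ∀ (i j : Fin m) → i ∈ A → j ∈ B → i ≡ j ⊎ q ≤ ∣ toℕ i - toℕ j ∣

-- Write q = p + 1 and call a position a hole if it lies in neither A nor B. Reading the path from
-- left to right, two consecutive elements of A ∪ B have at least p holes between them unless both
-- lie in A ∖ B or both in B ∖ A. If A = B this gives p (|A| - 1) holes, so s - 1 ≥ 1 + q (|A| - 1),
-- and equality forces the first element to be e_1 and all gaps to be exactly q. If A ≠ B, every
-- element of A ∩ B is cut off from both of its neighbours, and an element of A ∖ B is cut off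
-- from one of B ∖ A; hence there are at least max(|A ∩ B|, 1) such gaps, and at least
-- |A ∩ B| + 1 if neither set contains the other. Inclusion-exclusion,
-- |A| + |B| + #holes = (s - 1) + |A ∩ B|, turns these counts into the two claims of (ii).

module Submission where

open import Data.Bool.Base using (Bool; true; false)
open import Data.Empty using (⊥-elim)
open import Data.Fin.Base using (Fin; zero; suc; toℕ)
import Data.Fin.Properties as Finₚ
open import Data.Fin.Subset using (Subset; _∈_; _∉_; _⊆_; _∩_; _∪_; ∁; ∣_∣; Nonempty)
open import Data.Fin.Subset.Properties
  using (∣p∣≤n; ∣p∣≤∣x∷p∣; ∣∁p∣≡n∸∣p∣; ∩-comm; ∩-idem; ∪-comm; ∪-idem; x∈p∩q⁺; x∈p∩q⁻;
         drop-there; in⊆in; out⊆; ⊆-antisym; _∈?_)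
open import Data.Nat.Base using (ℕ; zero; suc; _+_; _*_; _∸_; _≤_; _<_; z≤n; s≤s; s≤s⁻¹; NonZero)
open import Data.Nat.Divisibility using (_∣_; _∣0; ∣-refl; ∣m∣n⇒∣m+n; ∣m+n∣m⇒∣n; >⇒∤)
open import Data.Nat.Properties
open import Data.Product using (_×_; _,_; ∃-syntax; proj₁; proj₂)
open import Data.Sum using (_⊎_; inj₁; inj₂)
import Data.Sum as Sum
open import Data.Vec.Base using ([]; _∷_; here; there)
open import Function.Base using (_∘_)
open import Function.Bundles using (_⇔_; mk⇔)
open import Function.Properties.Equivalence using () renaming (sym to ⇔-sym; trans to ⇔-trans)
open import Relation.Nullary.Decidable using (yes; no)
open import Relation.Binary.PropositionalEquality
  using (_≡_; _≢_; refl; sym; trans; cong; subst; subst₂; module ≡-Reasoning)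

open import Defs

private
  variable
    a d m n o p t : ℕ
    x y : Bool
    A B X : Subset n

m∸1+n≤o⇒m+n≤1+o : ∀ m → m ∸ 1 + n ≤ o → m + n ≤ suc o
m∸1+n≤o⇒m+n≤1+o {n} m le = ≤-trans (+-monoˡ-≤ n (m≤n+m∸n m 1)) (s≤s le)

m+n≤o+m⇒n≤o : m + n ≤ o + m → n ≤ o
m+n≤o+m⇒n≤o {m} {n} {o} le = +-cancelˡ-≤ m n o (subst (m + n ≤_) (+-comm o m) le)

m+n≤[1+m]*n : ∀ m n .{{_ : NonZero n}} → m + n ≤ suc m * n
m+n≤[1+m]*n m n = begin
  m + n      ≡⟨ +-comm m n ⟩
  n + m      ≤⟨ +-monoʳ-≤ n (m≤m*n m n) ⟩
  n + m * n  ∎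
  where open ≤-Reasoning

0<m⇒m*n≤o⇒m+n≤o+1 : .{{NonZero n}} → 0 < m → m * n ≤ o → m + n ≤ o + 1
0<m⇒m*n≤o⇒m+n≤o+1 {n} {suc m} {o} _ le = begin
  suc m + n        ≤⟨ s≤s (m+n≤[1+m]*n m n) ⟩
  suc (suc m * n)  ≤⟨ s≤s le ⟩
  suc o            ≡⟨ +-comm 1 o ⟩
  o + 1            ∎
  where open ≤-Reasoning

size-bound⇒length-bound : 0 < a → a * suc p ≤ n + p → 1 + suc p * (a ∸ 1) ≤ n
size-bound⇒length-bound {suc a} {p} {n} _ le = +-cancelˡ-≤ p _ _ (begin
  p + suc (suc p * a)  ≡⟨ +-suc p _ ⟩
  suc (p + suc p * a)  ≡⟨ cong (λ m → suc (p + m)) (*-comm (suc p) a) ⟩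
  suc (p + a * suc p)  ≤⟨ le ⟩
  n + p                ≡⟨ +-comm n p ⟩
  p + n                ∎)
  where open ≤-Reasoning

length-tight⇒size-tight : 0 < a → n ≡ 1 + suc p * (a ∸ 1) → 0 + a * suc p ≡ n + p
length-tight⇒size-tight {suc a} {p = p} _ refl =
  cong suc (trans (+-comm p _) (cong (_+ p) (*-comm a (suc p))))

∣p∩q∣+∣p∪q∣≡∣p∣+∣q∣ : (A B : Subset n) → ∣ A ∩ B ∣ + ∣ A ∪ B ∣ ≡ ∣ A ∣ + ∣ B ∣
∣p∩q∣+∣p∪q∣≡∣p∣+∣q∣ [] [] = refl
∣p∩q∣+∣p∪q∣≡∣p∣+∣q∣ (true ∷ A) (true ∷ B) =
  cong suc (trans (+-suc _ _) (trans (cong suc (∣p∩q∣+∣p∪q∣≡∣p∣+∣q∣ A B)) (sym (+-suc _ _))))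
∣p∩q∣+∣p∪q∣≡∣p∣+∣q∣ (true ∷ A) (false ∷ B) = trans (+-suc _ _) (cong suc (∣p∩q∣+∣p∪q∣≡∣p∣+∣q∣ A B))
∣p∩q∣+∣p∪q∣≡∣p∣+∣q∣ (false ∷ A) (true ∷ B) =
  trans (+-suc _ _) (trans (cong suc (∣p∩q∣+∣p∪q∣≡∣p∣+∣q∣ A B)) (sym (+-suc _ _)))
∣p∩q∣+∣p∪q∣≡∣p∣+∣q∣ (false ∷ A) (false ∷ B) = ∣p∩q∣+∣p∪q∣≡∣p∣+∣q∣ A B

∣p∣+∣∁p∣≡n : (A : Subset n) → ∣ A ∣ + ∣ ∁ A ∣ ≡ n
∣p∣+∣∁p∣≡n A = trans (cong (∣ A ∣ +_) (∣∁p∣≡n∸∣p∣ A)) (m+[n∸m]≡n (∣p∣≤n A))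

x∈p⇒0<∣p∣ : {i : Fin n} → i ∈ A → 0 < ∣ A ∣
x∈p⇒0<∣p∣ here = s≤s z≤n
x∈p⇒0<∣p∣ {A = x ∷ A} (there i∈A) = ≤-trans (x∈p⇒0<∣p∣ i∈A) (∣p∣≤∣x∷p∣ x A)

⊆⊎⊈ : (A B : Subset n) → A ⊆ B ⊎ ∃[ i ] (i ∈ A × i ∉ B)
⊆⊎⊈ [] [] = inj₁ λ ()
⊆⊎⊈ (x ∷ A) (y ∷ B) with ⊆⊎⊈ A B
... | inj₂ (i , i∈A , i∉B) = inj₂ (suc i , there i∈A , i∉B ∘ drop-there)
⊆⊎⊈ (true ∷ A) (false ∷ B) | inj₁ _ = inj₂ (zero , here , λ ())
⊆⊎⊈ (true ∷ A) (true ∷ B) | inj₁ A⊆B = inj₁ (in⊆in A⊆B)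
⊆⊎⊈ (false ∷ A) (y ∷ B) | inj₁ A⊆B = inj₁ (out⊆ A⊆B)

common : Subset n → Subset n → ℕ
common A B = ∣ A ∩ B ∣

holes : Subset n → Subset n → ℕ
holes A B = ∣ ∁ (A ∪ B) ∣

common-comm : (A B : Subset n) → common A B ≡ common B A
common-comm A B = cong ∣_∣ (∩-comm A B)

holes-comm : (A B : Subset n) → holes A B ≡ holes B A
holes-comm A B = cong (∣_∣ ∘ ∁) (∪-comm A B)

∣p∣+∣q∣+holes≡n+common : (A B : Subset n) → ∣ A ∣ + ∣ B ∣ + holes A B ≡ n + common A B
∣p∣+∣q∣+holes≡n+common {n} A B = begin
  ∣ A ∣ + ∣ B ∣ + holes A B             ≡⟨ cong (_+ holes A B) (∣p∩q∣+∣p∪q∣≡∣p∣+∣q∣ A B) ⟨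
  common A B + ∣ A ∪ B ∣ + holes A B    ≡⟨ +-assoc (common A B) _ _ ⟩
  common A B + (∣ A ∪ B ∣ + holes A B)  ≡⟨ cong (common A B +_) (∣p∣+∣∁p∣≡n (A ∪ B)) ⟩
  common A B + n                        ≡⟨ +-comm (common A B) n ⟩
  n + common A B                        ∎
  where open ≡-Reasoning

LowerBound : ℕ → Subset n → Set
LowerBound t X = ∀ i → i ∈ X → t ≤ toℕ i

LowerBound-zero : LowerBound 0 X
LowerBound-zero _ _ = z≤n

LowerBound-head : LowerBound t (true ∷ X) → t ≡ 0
LowerBound-head lb = n≤0⇒n≡0 (lb zero here)

LowerBound-tail : LowerBound t (x ∷ X) → LowerBound (t ∸ 1) X
LowerBound-tail lb i i∈X = ∸-monoˡ-≤ 1 (lb (suc i) (there i∈X))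

LowerBound-∩ˡ : LowerBound t A → LowerBound t (A ∩ B)
LowerBound-∩ˡ {A = A} {B = B} lb i i∈A∩B = lb i (proj₁ (x∈p∩q⁻ A B i∈A∩B))

LowerBound-∩ʳ : LowerBound t B → LowerBound t (A ∩ B)
LowerBound-∩ʳ {B = B} {A = A} lb i i∈A∩B = lb i (proj₂ (x∈p∩q⁻ A B i∈A∩B))

Separated-sym : Separated t A B → Separated t B A
Separated-sym sep i j i∈B j∈A =
  Sum.map sym (subst (_ ≤_) (∣-∣-comm (toℕ j) (toℕ i))) (sep j i j∈A i∈B)

Separated-tail : Separated t (x ∷ A) (y ∷ B) → Separated t A B
Separated-tail sep i j i∈A j∈B =
  Sum.map₁ Finₚ.suc-injective (sep (suc i) (suc j) (there i∈A) (there j∈B))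

Separated-headˡ : Separated (suc p) (true ∷ A) (y ∷ B) → LowerBound p B
Separated-headˡ sep j j∈B with sep zero (suc j) here (there j∈B)
... | inj₂ 1+p≤1+j = s≤s⁻¹ 1+p≤1+j

Separated-headʳ : Separated (suc p) (x ∷ A) (true ∷ B) → LowerBound p A
Separated-headʳ sep = Separated-headˡ (Separated-sym sep)

-- t counts the holes in front of the first element; it is how the recursion remembers the gap it
-- is currently inside.
holes-common : (t : ℕ) (A B : Subset n) → t ≤ p → Separated (suc p) A B → LowerBound t (A ∩ B) →
               t + common A B * p ≤ holes A B + p
holes-common t [] [] t≤p _ _ = ≤-trans (≤-reflexive (+-identityʳ t)) t≤p
holes-common {p = p} t (true ∷ A) (true ∷ B) _ sep lb rewrite LowerBound-head lb =
  holes-common p A B ≤-refl (Separated-tail sep) (LowerBound-∩ˡ (Separated-headʳ sep))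
holes-common {p = p} t (true ∷ A) (false ∷ B) t≤p sep _ = ≤-trans (+-monoˡ-≤ _ t≤p)
  (holes-common p A B ≤-refl (Separated-tail sep) (LowerBound-∩ʳ (Separated-headˡ sep)))
holes-common {p = p} t (false ∷ A) (true ∷ B) t≤p sep _ = ≤-trans (+-monoˡ-≤ _ t≤p)
  (holes-common p A B ≤-refl (Separated-tail sep) (LowerBound-∩ˡ (Separated-headʳ sep)))
holes-common t (false ∷ A) (false ∷ B) t≤p sep lb = m∸1+n≤o⇒m+n≤1+o t
  (holes-common (t ∸ 1) A B (≤-trans (m∸n≤m t 1) t≤p) (Separated-tail sep) (LowerBound-tail lb))

holes-common-⊈ : (t : ℕ) (A B : Subset n) {w : Fin n} → t ≤ p → Separated (suc p) A B → LowerBound t A →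
                 w ∈ A → w ∉ B → t + suc (common A B) * p ≤ holes A B + p
holes-common-⊈ t (true ∷ A) (true ∷ B) _ _ _ here w∉B = ⊥-elim (w∉B here)
holes-common-⊈ {p = p} t (true ∷ A) (true ∷ B) _ sep lb (there w∈A) w∉B rewrite LowerBound-head lb =
  holes-common-⊈ p A B ≤-refl (Separated-tail sep) (Separated-headʳ sep) w∈A (w∉B ∘ there)
holes-common-⊈ {p = p} t (true ∷ A) (false ∷ B) _ sep lb _ _ rewrite LowerBound-head lb =
  holes-common p A B ≤-refl (Separated-tail sep) (LowerBound-∩ʳ (Separated-headˡ sep))
holes-common-⊈ {p = p} t (false ∷ A) (true ∷ B) t≤p sep _ (there w∈A) w∉B = ≤-trans (+-monoˡ-≤ _ t≤p)
  (holes-common-⊈ p A B ≤-refl (Separated-tail sep) (Separated-headʳ sep) w∈A (w∉B ∘ there))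
holes-common-⊈ t (false ∷ A) (false ∷ B) t≤p sep lb (there w∈A) w∉B = m∸1+n≤o⇒m+n≤1+o t
  (holes-common-⊈ (t ∸ 1) A B (≤-trans (m∸n≤m t 1) t≤p) (Separated-tail sep) (LowerBound-tail lb)
    w∈A (w∉B ∘ there))

holes-common-⊉ : (t : ℕ) (A B : Subset n) {v : Fin n} → t ≤ p → Separated (suc p) A B → LowerBound t B →
                 v ∈ B → v ∉ A → t + suc (common A B) * p ≤ holes A B + p
holes-common-⊉ {p = p} t A B t≤p sep lb v∈B v∉A =
  subst₂ (λ c h → t + suc c * p ≤ h + p) (common-comm B A) (holes-comm B A)
    (holes-common-⊈ t B A t≤p (Separated-sym sep) lb v∈B v∉A)

holes-common-incomparable : (t : ℕ) (A B : Subset n) {w v : Fin n} → Separated (suc p) A B →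
  LowerBound t A → LowerBound t B → w ∈ A → w ∉ B → v ∈ B → v ∉ A →
  t + suc (common A B) * p ≤ holes A B
holes-common-incomparable t (true ∷ A) (true ∷ B) _ _ _ here w∉B _ _ = ⊥-elim (w∉B here)
holes-common-incomparable t (true ∷ A) (true ∷ B) _ _ _ (there _) _ here v∉A = ⊥-elim (v∉A here)
holes-common-incomparable {p = p} t (true ∷ A) (true ∷ B) sep lbA _ (there w∈A) w∉B (there v∈B) v∉A
  rewrite LowerBound-head lbA =
  holes-common-incomparable p A B (Separated-tail sep) (Separated-headʳ sep) (Separated-headˡ sep)
    w∈A (w∉B ∘ there) v∈B (v∉A ∘ there)
holes-common-incomparable {p = p} t (true ∷ A) (false ∷ B) sep lbA _ here _ (there v∈B) v∉A
  rewrite LowerBound-head lbA =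
  m+n≤o+m⇒n≤o (holes-common-⊉ p A B ≤-refl (Separated-tail sep) (Separated-headˡ sep) v∈B (v∉A ∘ there))
holes-common-incomparable t (true ∷ A) (false ∷ B) sep lbA _ (there w∈A) w∉B (there v∈B) v∉A
  rewrite LowerBound-head lbA =
  holes-common-incomparable 0 A B (Separated-tail sep) LowerBound-zero LowerBound-zero
    w∈A (w∉B ∘ there) v∈B (v∉A ∘ there)
holes-common-incomparable {p = p} t (false ∷ A) (true ∷ B) sep _ lbB (there w∈A) w∉B here _
  rewrite LowerBound-head lbB =
  m+n≤o+m⇒n≤o (holes-common-⊈ p A B ≤-refl (Separated-tail sep) (Separated-headʳ sep) w∈A (w∉B ∘ there))
holes-common-incomparable t (false ∷ A) (true ∷ B) sep _ lbB (there w∈A) w∉B (there v∈B) v∉A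
  rewrite LowerBound-head lbB =
  holes-common-incomparable 0 A B (Separated-tail sep) LowerBound-zero LowerBound-zero
    w∈A (w∉B ∘ there) v∈B (v∉A ∘ there)
holes-common-incomparable t (false ∷ A) (false ∷ B) sep lbA lbB (there w∈A) w∉B (there v∈B) v∉A =
  m∸1+n≤o⇒m+n≤1+o t (holes-common-incomparable (t ∸ 1) A B (Separated-tail sep)
    (LowerBound-tail lbA) (LowerBound-tail lbB) w∈A (w∉B ∘ there) v∈B (v∉A ∘ there))

separated-self-bound : (k : ℕ) (A : Subset n) → k ≤ p → Separated (suc p) A A → LowerBound k A →
               k + ∣ A ∣ * suc p ≤ n + p
separated-self-bound {n} {p} k A k≤p sep lb = begin
  k + ∣ A ∣ * suc p          ≡⟨ cong (k +_) (*-suc ∣ A ∣ p) ⟩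
  k + (∣ A ∣ + ∣ A ∣ * p)    ≡⟨ +-assoc k ∣ A ∣ _ ⟨
  k + ∣ A ∣ + ∣ A ∣ * p      ≡⟨ cong (_+ ∣ A ∣ * p) (+-comm k ∣ A ∣) ⟩
  ∣ A ∣ + k + ∣ A ∣ * p      ≡⟨ +-assoc ∣ A ∣ k _ ⟩
  ∣ A ∣ + (k + ∣ A ∣ * p)    ≤⟨ +-monoʳ-≤ ∣ A ∣ holes-A ⟩
  ∣ A ∣ + (∣ ∁ A ∣ + p)      ≡⟨ +-assoc ∣ A ∣ _ p ⟨
  ∣ A ∣ + ∣ ∁ A ∣ + p        ≡⟨ cong (_+ p) (∣p∣+∣∁p∣≡n A) ⟩
  n + p                      ∎
  where
  open ≤-Reasoning
  holes-A : k + ∣ A ∣ * p ≤ ∣ ∁ A ∣ + p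
  holes-A = subst₂ (λ c h → k + c * p ≤ h + p) (cong ∣_∣ (∩-idem A)) (cong (∣_∣ ∘ ∁) (∪-idem A))
              (holes-common k A A k≤p sep (LowerBound-∩ˡ lb))

n∣n+m⇔n∣m : ∀ n m → (n ∣ n + m) ⇔ (n ∣ m)
n∣n+m⇔n∣m n m = mk⇔ (λ n∣n+m → ∣m+n∣m⇒∣n n∣n+m ∣-refl) (∣m∣n⇒∣m+n ∣-refl)

-- Tightness forces A to be the progression k, k + q, k + 2q, … (q = suc p); with k + r = p,
-- membership in it is divisibility of (r + 1) + i by q.
separated-self-tight : (k r : ℕ) (A : Subset n) → k + r ≡ p → Separated (suc p) A A → LowerBound k A →
               k + ∣ A ∣ * suc p ≡ n + p → ∀ i → (i ∈ A) ⇔ (suc p ∣ suc r + toℕ i)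
separated-self-tight (suc k) r (true ∷ A) _ _ lb _ _ = ⊥-elim (n≮0 (lb zero here))
separated-self-tight zero r (true ∷ A) refl _ _ _ zero =
  mk⇔ (λ _ → ∣m∣n⇒∣m+n ∣-refl (suc r ∣0)) (λ _ → here)
separated-self-tight zero r (true ∷ A) refl sep _ tight (suc i) =
  ⇔-trans (mk⇔ drop-there there)
    (⇔-trans (separated-self-tight r 0 A (+-identityʳ r) (Separated-tail sep) (Separated-headˡ sep)
                (suc-injective tight) i)
      (⇔-sym (n∣n+m⇔n∣m (suc r) (suc (toℕ i)))))
separated-self-tight {suc n} {p} zero r (false ∷ A) _ sep _ tight _ =
  ⊥-elim (1+n≰n (subst (_≤ n + p) tight
    (separated-self-bound 0 A z≤n (Separated-tail sep) LowerBound-zero)))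
separated-self-tight {p = p} (suc k) r (false ∷ A) k+r≡p _ _ _ zero =
  mk⇔ (λ ()) (λ p+1∣r+1 → ⊥-elim (>⇒∤ (s≤s (subst (_≤ p) (sym (+-identityʳ (suc r))) r<p)) p+1∣r+1))
  where
  r<p : r < p
  r<p = subst (r <_) k+r≡p (s≤s (m≤n+m r k))
separated-self-tight {p = p} (suc k) r (false ∷ A) k+r≡p sep lb tight (suc i) =
  ⇔-trans (mk⇔ drop-there there)
    (subst (λ m → (i ∈ A) ⇔ (suc p ∣ m)) (sym (+-suc (suc r) (toℕ i)))
      (separated-self-tight k (suc r) A (trans (+-suc k r) k+r≡p) (Separated-tail sep)
        (LowerBound-tail lb) (suc-injective tight) i))

equal-sets-bound : {A : Subset n} → Separated (suc p) A A → Nonempty A → 1 + suc p * (∣ A ∣ ∸ 1) ≤ n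
equal-sets-bound {A = A} sep (_ , j∈A) =
  size-bound⇒length-bound (x∈p⇒0<∣p∣ j∈A) (separated-self-bound 0 A z≤n sep LowerBound-zero)

equal-sets-tight : {A : Subset n} → Separated (suc p) A A → Nonempty A → n ≡ 1 + suc p * (∣ A ∣ ∸ 1) →
                   ∀ i → (i ∈ A) ⇔ (suc p ∣ toℕ i)
equal-sets-tight {p = p} {A = A} sep (_ , j∈A) tight i =
  ⇔-trans (separated-self-tight 0 p A refl sep LowerBound-zero
             (length-tight⇒size-tight (x∈p⇒0<∣p∣ j∈A) tight) i)
          (n∣n+m⇔n∣m (suc p) (toℕ i))

holes-⊈ : {A B : Subset n} {w : Fin n} → .{{NonZero p}} → Separated (suc p) A B →
          w ∈ A → w ∉ B → Nonempty B → common A B + p ≤ holes A B + 1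
holes-⊈ {p = p} {A = A} {B} sep w∈A w∉B (v , v∈B) with v ∈? A
... | yes v∈A = 0<m⇒m*n≤o⇒m+n≤o+1 (x∈p⇒0<∣p∣ (x∈p∩q⁺ (v∈A , v∈B)))
                  (m+n≤o+m⇒n≤o (holes-common-⊈ 0 A B z≤n sep LowerBound-zero w∈A w∉B))
... | no v∉A = begin
  common A B + p        ≤⟨ m+n≤[1+m]*n (common A B) p ⟩
  suc (common A B) * p  ≤⟨ holes-common-incomparable 0 A B sep LowerBound-zero LowerBound-zero
                                                     w∈A w∉B v∈B v∉A ⟩
  holes A B             ≤⟨ m≤m+n (holes A B) 1 ⟩
  holes A B + 1         ∎
  where open ≤-Reasoning

holes-distinct : .{{NonZero p}} → Separated (suc p) A B → Nonempty A → Nonempty B → B ≢ A →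
                 common A B + p ≤ holes A B + 1
holes-distinct {p = p} {A = A} {B} sep neA neB B≢A with ⊆⊎⊈ A B
... | inj₂ (w , w∈A , w∉B) = holes-⊈ sep w∈A w∉B neB
... | inj₁ A⊆B with ⊆⊎⊈ B A
...   | inj₁ B⊆A = ⊥-elim (B≢A (⊆-antisym B⊆A A⊆B))
...   | inj₂ (v , v∈B , v∉A) = subst₂ (λ c h → c + p ≤ h + 1) (common-comm B A) (holes-comm B A)
                                 (holes-⊈ (Separated-sym sep) v∈B v∉A neA)

exclusion-bound : (A B : Subset n) → common A B + p ≤ holes A B + d → ∣ A ∣ + ∣ B ∣ + p ≤ n + d
exclusion-bound {n} {p} {d} A B le = +-cancelʳ-≤ (holes A B) _ _ (begin
  ∣ A ∣ + ∣ B ∣ + p + holes A B    ≡⟨ +-assoc (∣ A ∣ + ∣ B ∣) p _ ⟩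
  ∣ A ∣ + ∣ B ∣ + (p + holes A B)  ≡⟨ cong (∣ A ∣ + ∣ B ∣ +_) (+-comm p _) ⟩
  ∣ A ∣ + ∣ B ∣ + (holes A B + p)  ≡⟨ +-assoc (∣ A ∣ + ∣ B ∣) _ p ⟨
  ∣ A ∣ + ∣ B ∣ + holes A B + p    ≡⟨ cong (_+ p) (∣p∣+∣q∣+holes≡n+common A B) ⟩
  n + common A B + p              ≡⟨ +-assoc n _ p ⟩
  n + (common A B + p)            ≤⟨ +-monoʳ-≤ n le ⟩
  n + (holes A B + d)             ≡⟨ cong (n +_) (+-comm _ d) ⟩
  n + (d + holes A B)             ≡⟨ +-assoc n d _ ⟨
  n + d + holes A B               ∎)
  where open ≤-Reasoning

distinct-sets-bound : {A B : Subset n} → .{{NonZero p}} → Separated (suc p) A B →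
                      Nonempty A → Nonempty B → B ≢ A → ∣ A ∣ + ∣ B ∣ + suc p ∸ 2 ≤ n
distinct-sets-bound {n = n} {p = p} {A = A} {B} sep neA neB B≢A =
  m≤n+o⇒m∸n≤o (∣ A ∣ + ∣ B ∣ + suc p) 2 (begin
    ∣ A ∣ + ∣ B ∣ + suc p    ≡⟨ +-suc _ p ⟩
    suc (∣ A ∣ + ∣ B ∣ + p)  ≤⟨ s≤s (exclusion-bound A B (holes-distinct sep neA neB B≢A)) ⟩
    suc (n + 1)             ≡⟨ cong suc (+-comm n 1) ⟩
    2 + n                   ∎)
  where open ≤-Reasoning

distinct-sets-tight : {A B : Subset n} → Separated (suc (suc p)) A B →
                      n ≡ ∣ A ∣ + ∣ B ∣ + suc (suc p) ∸ 2 → A ⊆ B ⊎ B ⊆ A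
distinct-sets-tight {n = n} {p = p} {A = A} {B} sep n≡ with ⊆⊎⊈ A B | ⊆⊎⊈ B A
... | inj₁ A⊆B | _ = inj₁ A⊆B
... | inj₂ _ | inj₁ B⊆A = inj₂ B⊆A
... | inj₂ (w , w∈A , w∉B) | inj₂ (v , v∈B , v∉A) = ⊥-elim (1+n≰n (begin
  suc (∣ A ∣ + ∣ B ∣ + p)         ≡⟨ +-suc _ p ⟨
  ∣ A ∣ + ∣ B ∣ + suc p           ≤⟨ exclusion-bound A B few-holes ⟩
  n + 0                          ≡⟨ +-identityʳ n ⟩
  n                              ≡⟨ n≡ ⟩
  ∣ A ∣ + ∣ B ∣ + suc (suc p) ∸ 2 ≡⟨ cong (_∸ 2) (trans (+-suc _ (suc p)) (cong suc (+-suc _ p))) ⟩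
  ∣ A ∣ + ∣ B ∣ + p               ∎))
  where
  open ≤-Reasoning
  few-holes : common A B + suc p ≤ holes A B + 0
  few-holes = begin
    common A B + suc p            ≤⟨ m+n≤[1+m]*n (common A B) (suc p) ⟩
    suc (common A B) * suc p      ≤⟨ holes-common-incomparable 0 A B sep LowerBound-zero LowerBound-zero
                                                               w∈A w∉B v∈B v∉A ⟩
    holes A B                     ≡⟨ +-identityʳ _ ⟨
    holes A B + 0                 ∎

lemma4 : (s q : ℕ) → 2 ≤ q → (A B : Subset (s ∸ 1)) → Nonempty A → Nonempty B → Separated q A B →
         ((A ≡ B → (1 + q * (∣ A ∣ ∸ 1) ≤ s ∸ 1)
                   × (s ∸ 1 ≡ 1 + q * (∣ A ∣ ∸ 1) → ∀ (i : Fin (s ∸ 1)) → ((i ∈ A) ⇔ (q ∣ toℕ i))))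
         × (B ≢ A → (∣ A ∣ + ∣ B ∣ + q ∸ 2 ≤ s ∸ 1)
                   × (s ∸ 1 ≡ ∣ A ∣ + ∣ B ∣ + q ∸ 2 → A ⊆ B ⊎ B ⊆ A)))
lemma4 s q (s≤s (s≤s z≤n)) A B neA neB sep =
    (λ A≡B → let sepA = subst (Separated q A) (sym A≡B) sep in
               equal-sets-bound sepA neA , equal-sets-tight sepA neA)
  , (λ B≢A → distinct-sets-bound sep neA neB B≢A , distinct-sets-tight sep)
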